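{- (1) Any biclosed monoidal structure on $\mathsf{DiGraph}$ must have unit $J_0$. (2) Any biclosed monoidal structure on $\mathsf{Graph}$ must have unit $I_0$.
   Context: $\mathsf{DiGraph}$ is the category of directed reflexive graphs (sets with a reflexive relation, and relation-preserving maps); $\mathsf{Graph}$ is the category of undirected reflexive graphs (sets with a reflexive symmetric relation, and relation-preserving maps). $J_0$ and $I_0$ denote the graph with a single vertex (the terminal object) in $\mathsf{DiGraph}$ and $\mathsf{Graph}$ respectively. A monoidal category is biclosed if for every object $X$ both $X\otimes-$ and $-\otimes X$ have right adjoints. -}

module Defs where

open import Level using () renaming (suc to lsuc; zero to lzero)
open import Data.Unit using (⊤; tt)
open import Data.Product using (Σ; _×_; _,_; proj₁; proj₂)
open import Relation.Binary.PropositionalEquality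
  using (_≡_; refl; sym; trans; cong)
open import Relation.Binary.Structures using (IsEquivalence)

record Category : Set₂ where
  infixr 9 _∘_
  infix  4 _≈_
  field
    Obj     : Set₁
    _⇒_     : Obj → Obj → Set
    _≈_     : ∀ {A B} → A ⇒ B → A ⇒ B → Set
    ≈-equiv : ∀ {A B} → IsEquivalence (_≈_ {A} {B})
    id      : ∀ {A} → A ⇒ A
    _∘_     : ∀ {A B C} → B ⇒ C → A ⇒ B → A ⇒ C
    identityˡ : ∀ {A B} {f : A ⇒ B} → id ∘ f ≈ f
    identityʳ : ∀ {A B} {f : A ⇒ B} → f ∘ id ≈ f
    assoc     : ∀ {A B C D} {f : A ⇒ B} {g : B ⇒ C} {h : C ⇒ D} →
                (h ∘ g) ∘ f ≈ h ∘ (g ∘ f)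
    ∘-resp-≈  : ∀ {A B C} {f f′ : B ⇒ C} {g g′ : A ⇒ B} →
                f ≈ f′ → g ≈ g′ → f ∘ g ≈ f′ ∘ g′

record Iso (𝒞 : Category) (A B : Category.Obj 𝒞) : Set where
  open Category 𝒞
  field
    to   : A ⇒ B
    from : B ⇒ A
    isoˡ : from ∘ to ≈ id
    isoʳ : to ∘ from ≈ id

record Monoidal (𝒞 : Category) : Set₁ where
  open Category 𝒞
  infixr 10 _⊗₀_ _⊗₁_
  field
    _⊗₀_ : Obj → Obj → Obj
    _⊗₁_ : ∀ {A B C D} → A ⇒ B → C ⇒ D → (A ⊗₀ C) ⇒ (B ⊗₀ D)
    ⊗-identity : ∀ {A C} → (id {A}) ⊗₁ (id {C}) ≈ id
    ⊗-homomorphism : ∀ {A B C D E F}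
      {f : A ⇒ B} {g : B ⇒ C} {h : D ⇒ E} {k : E ⇒ F} →
      (g ∘ f) ⊗₁ (k ∘ h) ≈ (g ⊗₁ k) ∘ (f ⊗₁ h)
    ⊗-resp-≈ : ∀ {A B C D} {f f′ : A ⇒ B} {g g′ : C ⇒ D} →
      f ≈ f′ → g ≈ g′ → f ⊗₁ g ≈ f′ ⊗₁ g′
    unit : Obj
    associator : ∀ X Y Z → Iso 𝒞 ((X ⊗₀ Y) ⊗₀ Z) (X ⊗₀ (Y ⊗₀ Z))
    unitorˡ    : ∀ X → Iso 𝒞 (unit ⊗₀ X) X
    unitorʳ    : ∀ X → Iso 𝒞 (X ⊗₀ unit) X
    assoc-natural : ∀ {X X′ Y Y′ Z Z′}
      {f : X ⇒ X′} {g : Y ⇒ Y′} {h : Z ⇒ Z′} →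
      Iso.to (associator X′ Y′ Z′) ∘ ((f ⊗₁ g) ⊗₁ h)
        ≈ (f ⊗₁ (g ⊗₁ h)) ∘ Iso.to (associator X Y Z)
    unitorˡ-natural : ∀ {X X′} {f : X ⇒ X′} →
      Iso.to (unitorˡ X′) ∘ (id ⊗₁ f) ≈ f ∘ Iso.to (unitorˡ X)
    unitorʳ-natural : ∀ {X X′} {f : X ⇒ X′} →
      Iso.to (unitorʳ X′) ∘ (f ⊗₁ id) ≈ f ∘ Iso.to (unitorʳ X)
    pentagon : ∀ {X Y Z W} →
      Iso.to (associator X Y (Z ⊗₀ W)) ∘ Iso.to (associator (X ⊗₀ Y) Z W)
        ≈ (id ⊗₁ Iso.to (associator Y Z W))
          ∘ (Iso.to (associator X (Y ⊗₀ Z) W)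
          ∘ (Iso.to (associator X Y Z) ⊗₁ id))
    triangle : ∀ {X Y} →
      (id ⊗₁ Iso.to (unitorˡ Y)) ∘ Iso.to (associator X unit Y)
        ≈ Iso.to (unitorʳ X) ⊗₁ id

-- Biclosedness: for every X, both X ⊗ - and - ⊗ X have right adjoints,
-- expressed pointwise by universal arrows (a functor has a right adjoint
-- iff every object Y admits a universal arrow from the functor to Y).
module _ {𝒞 : Category} (M : Monoidal 𝒞) where
  open Category 𝒞
  open Monoidal M

  record LeftExp (X Y : Obj) : Set₁ where
    field
      exp  : Obj
      eval : (X ⊗₀ exp) ⇒ Y
      curry : ∀ {Z} (f : (X ⊗₀ Z) ⇒ Y) →
        Σ (Z ⇒ exp) λ g →
          (eval ∘ (id ⊗₁ g) ≈ f) ×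
          (∀ (g′ : Z ⇒ exp) → eval ∘ (id ⊗₁ g′) ≈ f → g′ ≈ g)

  record RightExp (X Y : Obj) : Set₁ where
    field
      exp  : Obj
      eval : (exp ⊗₀ X) ⇒ Y
      curry : ∀ {Z} (f : (Z ⊗₀ X) ⇒ Y) →
        Σ (Z ⇒ exp) λ g →
          (eval ∘ (g ⊗₁ id) ≈ f) ×
          (∀ (g′ : Z ⇒ exp) → eval ∘ (g′ ⊗₁ id) ≈ f → g′ ≈ g)

  record Biclosed : Set₁ where
    field
      leftClosed  : ∀ X Y → LeftExp X Y
      rightClosed : ∀ X Y → RightExp X Y

-- Reflexive directed graphs: a set with a reflexive (proposition-valued)
-- relation; morphisms are relation-preserving maps, identified when they
-- agree on vertices.

record DiGr : Set₁ where
  field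
    V      : Set
    E      : V → V → Set
    E-prop : ∀ {x y} (p q : E x y) → p ≡ q
    E-refl : ∀ x → E x x

record DiHom (G H : DiGr) : Set where
  field
    fun  : DiGr.V G → DiGr.V H
    pres : ∀ {x y} → DiGr.E G x y → DiGr.E H (fun x) (fun y)

open DiHom

private
  ptEquiv : ∀ {G H : DiGr} →
    IsEquivalence (λ (f g : DiHom G H) → ∀ x → fun f x ≡ fun g x)
  ptEquiv = record
    { refl  = λ _ → refl
    ; sym   = λ p x → sym (p x)
    ; trans = λ p q x → trans (p x) (q x) }

DiGraph : Category
DiGraph = record
  { Obj = DiGr
  ; _⇒_ = DiHom
  ; _≈_ = λ f g → ∀ x → fun f x ≡ fun g x
  ; ≈-equiv = ptEquiv
  ; id = record { fun = λ x → x ; pres = λ e → e }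
  ; _∘_ = λ f g → record { fun = λ x → fun f (fun g x)
                         ; pres = λ e → pres f (pres g e) }
  ; identityˡ = λ _ → refl
  ; identityʳ = λ _ → refl
  ; assoc = λ _ → refl
  ; ∘-resp-≈ = λ {_} {_} {_} {f} {f′} {g} {g′} p q x →
      trans (cong (fun f) (q x)) (p (fun g′ x))
  }

J₀ : DiGr
J₀ = record { V = ⊤ ; E = λ _ _ → ⊤ ; E-prop = λ _ _ → refl
            ; E-refl = λ _ → tt }

-- Reflexive undirected graphs: a set with a reflexive symmetric
-- (proposition-valued) relation.

record UGr : Set₁ where
  field
    V      : Set
    E      : V → V → Set
    E-prop : ∀ {x y} (p q : E x y) → p ≡ q
    E-refl : ∀ x → E x x
    E-sym  : ∀ {x y} → E x y → E y x

record UHom (G H : UGr) : Set where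
  field
    fun  : UGr.V G → UGr.V H
    pres : ∀ {x y} → UGr.E G x y → UGr.E H (fun x) (fun y)

open UHom renaming (fun to ufun; pres to upres)

private
  uptEquiv : ∀ {G H : UGr} →
    IsEquivalence (λ (f g : UHom G H) → ∀ x → ufun f x ≡ ufun g x)
  uptEquiv = record
    { refl  = λ _ → refl
    ; sym   = λ p x → sym (p x)
    ; trans = λ p q x → trans (p x) (q x) }

Graph : Category
Graph = record
  { Obj = UGr
  ; _⇒_ = UHom
  ; _≈_ = λ f g → ∀ x → ufun f x ≡ ufun g x
  ; ≈-equiv = uptEquiv
  ; id = record { fun = λ x → x ; pres = λ e → e }
  ; _∘_ = λ f g → record { fun = λ x → ufun f (ufun g x)
                         ; pres = λ e → upres f (upres g e) }
  ; identityˡ = λ _ → refl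
  ; identityʳ = λ _ → refl
  ; assoc = λ _ → refl
  ; ∘-resp-≈ = λ {_} {_} {_} {f} {f′} {g} {g′} p q x →
      trans (cong (ufun f) (q x)) (p (ufun g′ x))
  }

I₀ : UGr
I₀ = record { V = ⊤ ; E = λ _ _ → ⊤ ; E-prop = λ _ _ → refl
            ; E-refl = λ _ → tt ; E-sym = λ _ → tt }

{-# OPTIONS --safe #-}
-- In any monoidal category with a terminal object T, the unit I has at most
-- one point: for points x, z of I, the unitors send x ⊗ z to z ∘ ! and x ∘ !
-- respectively, which forces z = λ ∘ ρ⁻¹ ∘ x for every z.  It has at least
-- one point once - ⊗ T has a right adjoint [T, -]: I, having at most one
-- point, maps to [T, I] pointwise, and the transpose I ⊗ T ⇒ I of that map,
-- precomposed with λ⁻¹ : T ⇒ I ⊗ T, is a point of I.  In a well-pointed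
-- category such as graphs these two facts make I ≅ T.
module Submission where

open import Data.Product using (_×_; _,_; proj₁)
open import Data.Unit using (tt)
open import Relation.Binary.Bundles using (Setoid)
open import Relation.Binary.Structures using (IsEquivalence)
open import Relation.Binary.PropositionalEquality using (_≡_; refl; subst)
import Relation.Binary.Reasoning.Setoid as SetoidReasoning
open import Defs

module HomReasoning (𝒞 : Category) where
  open Category 𝒞

  hom-setoid : Obj → Obj → Setoid _ _
  hom-setoid A B = record { Carrier = A ⇒ B ; _≈_ = _≈_ ; isEquivalence = ≈-equiv }

  module _ {A B : Obj} where
    open SetoidReasoning (hom-setoid A B) public
    open IsEquivalence (≈-equiv {A} {B}) public
      renaming (refl to ≈-refl; sym to ≈-sym; trans to ≈-trans)

  refl⟩∘⟨_ : ∀ {A B C} {f : B ⇒ C} {g g′ : A ⇒ B} → g ≈ g′ → f ∘ g ≈ f ∘ g′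
  refl⟩∘⟨ p = ∘-resp-≈ ≈-refl p

  _⟩∘⟨refl : ∀ {A B C} {f f′ : B ⇒ C} {g : A ⇒ B} → f ≈ f′ → f ∘ g ≈ f′ ∘ g
  p ⟩∘⟨refl = ∘-resp-≈ p ≈-refl

module _ {𝒞 : Category} where
  open Category 𝒞
  open HomReasoning 𝒞

  switch-tofromˡ : ∀ {A B C} (i : Iso 𝒞 B C) {h : A ⇒ B} {k : A ⇒ C} →
    Iso.to i ∘ h ≈ k → h ≈ Iso.from i ∘ k
  switch-tofromˡ i {h} {k} to∘h≈k = begin
    h                           ≈⟨ ≈-sym identityˡ ⟩
    id ∘ h                      ≈⟨ ≈-sym (Iso.isoˡ i) ⟩∘⟨refl ⟩
    (Iso.from i ∘ Iso.to i) ∘ h ≈⟨ assoc ⟩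
    Iso.from i ∘ (Iso.to i ∘ h) ≈⟨ refl⟩∘⟨ to∘h≈k ⟩
    Iso.from i ∘ k              ∎

  record IsTerminal (T : Obj) : Set₁ where
    field
      !        : ∀ {A} → A ⇒ T
      !-unique : ∀ {A} (f : A ⇒ T) → f ≈ !

    !-unique₂ : ∀ {A} (f g : A ⇒ T) → f ≈ g
    !-unique₂ f g = ≈-trans (!-unique f) (≈-sym (!-unique g))

  record WellPointed (T : Obj) : Set₁ where
    field
      terminal       : IsTerminal T
      extensionality : ∀ {A B} {f g : A ⇒ B} → (∀ (x : T ⇒ A) → f ∘ x ≈ g ∘ x) → f ≈ g
      -- In graphs an object with at most one vertex has only loops, so any
      -- assignment of vertices out of it is a morphism.
      subsingleton-map : ∀ {A B} → (∀ (x y : T ⇒ A) → x ≈ y) → ((T ⇒ A) → (T ⇒ B)) → A ⇒ B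

module _ {𝒞 : Category} (M : Monoidal 𝒞) where
  open Category 𝒞
  open Monoidal M
  open HomReasoning 𝒞

  λ⇒ : ∀ X → (unit ⊗₀ X) ⇒ X
  λ⇒ X = Iso.to (unitorˡ X)

  ρ⇒ : ∀ X → (X ⊗₀ unit) ⇒ X
  ρ⇒ X = Iso.to (unitorʳ X)

  λ⇐ : ∀ X → X ⇒ (unit ⊗₀ X)
  λ⇐ X = Iso.from (unitorˡ X)

  ρ⇐ : ∀ X → X ⇒ (X ⊗₀ unit)
  ρ⇐ X = Iso.from (unitorʳ X)

  serialize₁₂ : ∀ {A B C D} {f : A ⇒ B} {g : C ⇒ D} → f ⊗₁ g ≈ (f ⊗₁ id) ∘ (id ⊗₁ g)
  serialize₁₂ {f = f} {g} = begin
    f ⊗₁ g                ≈⟨ ⊗-resp-≈ (≈-sym identityʳ) (≈-sym identityˡ) ⟩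
    (f ∘ id) ⊗₁ (id ∘ g)  ≈⟨ ⊗-homomorphism ⟩
    (f ⊗₁ id) ∘ (id ⊗₁ g) ∎

  serialize₂₁ : ∀ {A B C D} {f : A ⇒ B} {g : C ⇒ D} → f ⊗₁ g ≈ (id ⊗₁ g) ∘ (f ⊗₁ id)
  serialize₂₁ {f = f} {g} = begin
    f ⊗₁ g                ≈⟨ ⊗-resp-≈ (≈-sym identityˡ) (≈-sym identityʳ) ⟩
    (id ∘ f) ⊗₁ (g ∘ id)  ≈⟨ ⊗-homomorphism ⟩
    (id ⊗₁ g) ∘ (f ⊗₁ id) ∎

  unitorˡ-⊗ : ∀ {X Y Y′} {f : X ⇒ unit} {g : Y ⇒ Y′} →
    λ⇒ Y′ ∘ (f ⊗₁ g) ≈ g ∘ (λ⇒ Y ∘ (f ⊗₁ id))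
  unitorˡ-⊗ {Y = Y} {Y′} {f} {g} = begin
    λ⇒ Y′ ∘ (f ⊗₁ g)                  ≈⟨ refl⟩∘⟨ serialize₂₁ ⟩
    λ⇒ Y′ ∘ ((id ⊗₁ g) ∘ (f ⊗₁ id))   ≈⟨ ≈-sym assoc ⟩
    (λ⇒ Y′ ∘ (id ⊗₁ g)) ∘ (f ⊗₁ id)   ≈⟨ unitorˡ-natural ⟩∘⟨refl ⟩
    (g ∘ λ⇒ Y) ∘ (f ⊗₁ id)            ≈⟨ assoc ⟩
    g ∘ (λ⇒ Y ∘ (f ⊗₁ id))            ∎

  unitorʳ-⊗ : ∀ {X X′ Y} {f : X ⇒ X′} {g : Y ⇒ unit} →
    ρ⇒ X′ ∘ (f ⊗₁ g) ≈ f ∘ (ρ⇒ X ∘ (id ⊗₁ g))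
  unitorʳ-⊗ {X} {X′} {f = f} {g} = begin
    ρ⇒ X′ ∘ (f ⊗₁ g)                  ≈⟨ refl⟩∘⟨ serialize₁₂ ⟩
    ρ⇒ X′ ∘ ((f ⊗₁ id) ∘ (id ⊗₁ g))   ≈⟨ ≈-sym assoc ⟩
    (ρ⇒ X′ ∘ (f ⊗₁ id)) ∘ (id ⊗₁ g)   ≈⟨ unitorʳ-natural ⟩∘⟨refl ⟩
    (f ∘ ρ⇒ X) ∘ (id ⊗₁ g)            ≈⟨ assoc ⟩
    f ∘ (ρ⇒ X ∘ (id ⊗₁ g))            ∎

  module _ {T : Obj} (terminal : IsTerminal {𝒞} T) where
    open IsTerminal terminal

    cancel-! : ∀ {A B} → T ⇒ A → {f g : T ⇒ B} → f ∘ ! {A} ≈ g ∘ ! → f ≈ g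
    cancel-! p {f} {g} f∘!≈g∘! = begin
      f           ≈⟨ ≈-sym identityʳ ⟩
      f ∘ id      ≈⟨ refl⟩∘⟨ !-unique₂ id (! ∘ p) ⟩
      f ∘ (! ∘ p) ≈⟨ ≈-sym assoc ⟩
      (f ∘ !) ∘ p ≈⟨ f∘!≈g∘! ⟩∘⟨refl ⟩
      (g ∘ !) ∘ p ≈⟨ assoc ⟩
      g ∘ (! ∘ p) ≈⟨ refl⟩∘⟨ !-unique₂ (! ∘ p) id ⟩
      g ∘ id      ≈⟨ identityʳ ⟩
      g           ∎

    unitorˡ-points : ∀ (x z : T ⇒ unit) → λ⇒ unit ∘ (x ⊗₁ z) ≈ z ∘ !
    unitorˡ-points x z = ≈-trans unitorˡ-⊗ (refl⟩∘⟨ !-unique _)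

    unitorʳ-points : ∀ (x z : T ⇒ unit) → ρ⇒ unit ∘ (x ⊗₁ z) ≈ x ∘ !
    unitorʳ-points x z = ≈-trans unitorʳ-⊗ (refl⟩∘⟨ !-unique _)

    unit-point-determined : ∀ (x z : T ⇒ unit) → z ≈ λ⇒ unit ∘ (ρ⇐ unit ∘ x)
    unit-point-determined x z = cancel-! ((! ⊗₁ id) ∘ λ⇐ T) (begin
      z ∘ !                             ≈⟨ ≈-sym (unitorˡ-points x z) ⟩
      λ⇒ unit ∘ (x ⊗₁ z)                ≈⟨ refl⟩∘⟨ switch-tofromˡ (unitorʳ unit) (unitorʳ-points x z) ⟩
      λ⇒ unit ∘ (ρ⇐ unit ∘ (x ∘ !))     ≈⟨ ≈-sym (≈-trans assoc (refl⟩∘⟨ assoc)) ⟩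
      (λ⇒ unit ∘ (ρ⇐ unit ∘ x)) ∘ !     ∎)

    unit-points-unique : ∀ (x z : T ⇒ unit) → x ≈ z
    unit-points-unique x z = ≈-trans (unit-point-determined x x) (≈-sym (unit-point-determined x z))

  module _ {T : Obj} (wellPointed : WellPointed {𝒞} T) where
    open WellPointed wellPointed
    open IsTerminal terminal

    unit-point : RightExp M T unit → T ⇒ unit
    unit-point R = eval ∘ ((G ⊗₁ id) ∘ λ⇐ T)
      where
        open RightExp R
        G : unit ⇒ exp
        G = subsingleton-map (unit-points-unique terminal) (λ x → proj₁ (curry (x ∘ !)))

    unit≅terminal : RightExp M T unit → Iso 𝒞 unit T
    unit≅terminal R = record
      { to   = !
      ; from = unit-point R
      ; isoˡ = extensionality (λ x → unit-points-unique terminal _ _)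
      ; isoʳ = !-unique₂ _ _
      }

DiGraph-wellPointed : WellPointed {DiGraph} J₀
DiGraph-wellPointed = record
  { terminal         = record { ! = record { fun = λ _ → tt ; pres = λ _ → tt } ; !-unique = λ _ _ → refl }
  ; extensionality   = λ f∘x≈g∘x a → f∘x≈g∘x (point a) tt
  ; subsingleton-map = vertexwise
  }
  where
    point : ∀ {G} → DiGr.V G → DiHom J₀ G
    point {G} a = record { fun = λ _ → a ; pres = λ _ → DiGr.E-refl G a }

    vertexwise : ∀ {A B} → (∀ (x y : DiHom J₀ A) t → DiHom.fun x t ≡ DiHom.fun y t) →
                 (DiHom J₀ A → DiHom J₀ B) → DiHom A B
    vertexwise {A} {B} unique φ = record
      { fun  = f
      ; pres = λ {a} {b} _ →
          subst (λ c → DiGr.E B (f a) (f c)) (unique (point a) (point b) tt) (DiGr.E-refl B (f a))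
      }
      where
        f : DiGr.V A → DiGr.V B
        f a = DiHom.fun (φ (point a)) tt

Graph-wellPointed : WellPointed {Graph} I₀
Graph-wellPointed = record
  { terminal         = record { ! = record { fun = λ _ → tt ; pres = λ _ → tt } ; !-unique = λ _ _ → refl }
  ; extensionality   = λ f∘x≈g∘x a → f∘x≈g∘x (point a) tt
  ; subsingleton-map = vertexwise
  }
  where
    point : ∀ {G} → UGr.V G → UHom I₀ G
    point {G} a = record { fun = λ _ → a ; pres = λ _ → UGr.E-refl G a }

    vertexwise : ∀ {A B} → (∀ (x y : UHom I₀ A) t → UHom.fun x t ≡ UHom.fun y t) →
                 (UHom I₀ A → UHom I₀ B) → UHom A B
    vertexwise {A} {B} unique φ = record
      { fun  = f
      ; pres = λ {a} {b} _ →
          subst (λ c → UGr.E B (f a) (f c)) (unique (point a) (point b) tt) (UGr.E-refl B (f a))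
      }
      where
        f : UGr.V A → UGr.V B
        f a = UHom.fun (φ (point a)) tt

mainTheorem4 : (∀ (M : Monoidal DiGraph) → Biclosed M → Iso DiGraph (Monoidal.unit M) J₀)
    × (∀ (M : Monoidal Graph) → Biclosed M → Iso Graph (Monoidal.unit M) I₀)
mainTheorem4 =
    (λ M B → unit≅terminal M DiGraph-wellPointed (Biclosed.rightClosed B J₀ (Monoidal.unit M)))
  , (λ M B → unit≅terminal M Graph-wellPointed (Biclosed.rightClosed B I₀ (Monoidal.unit M)))
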